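{- Let $\mathcal{F}$ be a multidiforest. Then the complex of directed trees $DT(\mathcal{F})$ is vertex decomposable.
   Context: A multidigraph $G$ consists of finite sets $V$ (vertices) and $E$ (edges) with maps $s,t:E\to V$ (source and target); parallel edges are allowed. Its underlying graph $G^{un}$ has vertex set $V$, with $u,v$ adjacent iff some edge goes from $u$ to $v$ or from $v$ to $u$. $G$ is a multidiforest if $G^{un}$ is a forest. A directed cycle of $G$ is a connected subgraph $C$ in which every vertex of $C$ is the source of exactly one edge of $C$ and the target of exactly one edge of $C$. A directed forest is a multidigraph containing no directed cycle in which distinct edges have distinct targets. The complex of directed trees $DT(G)$ is the simplicial complex on vertex set $E$ whose simplices are the subsets $\sigma\subseteq E$ such that the subgraph with edge set $\sigma$ is a directed forest. For a simplicial complex $K$ and a vertex $v$, $\mathrm{lk}(v,K)=\{\tau\in K: v\notin\tau,\ \tau\cup\{v\}\in K\}$ and $\mathrm{del}(v,K)=\{\tau\in K: v\notin \tau\}$; $K$ is vertex decomposable if $K$ is a simplex, or $K$ has a vertex $v$ such that (i) both $\mathrm{lk}(v,K)$ and $\mathrm{del}(v,K)$ are vertex decomposable, and (ii) every facet of $\mathrm{del}(v,K)$ is a facet of $K$. -}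

module Defs where

open import Data.Nat using (ℕ)
open import Data.Empty using (⊥)
open import Data.Fin using (Fin)
open import Data.Fin.Subset using (Subset; _∈_; _∉_; _⊆_; _∪_; ⁅_⁆)
open import Data.List using (List; []; _∷_)
open import Data.List.Relation.Unary.Unique.Propositional using (Unique)
open import Data.Product using (Σ; ∃; _×_; _,_)
open import Data.Sum using (_⊎_)
open import Relation.Binary.PropositionalEquality using (_≡_; _≢_)
open import Relation.Nullary using (¬_)

record Multidigraph : Set where
  field
    nV : ℕ
    nE : ℕ
    src : Fin nE → Fin nV
    tgt : Fin nE → Fin nV

module _ (G : Multidigraph) where
  open Multidigraph G

  -- Underlying (simple) graph G^un: u ~ v iff u ≠ v and some edge
  -- goes from u to v or from v to u.

  Adj : Fin nV → Fin nV → Set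
  Adj u v = u ≢ v × ∃ λ e → (src e ≡ u × tgt e ≡ v) ⊎ (src e ≡ v × tgt e ≡ u)

  ClosesUp : Fin nV → Fin nV → List (Fin nV) → Set
  ClosesUp first x [] = Adj x first
  ClosesUp first x (y ∷ ys) = Adj x y × ClosesUp first y ys

  UnCycle : List (Fin nV) → Set
  UnCycle [] = ⊥
  UnCycle (_ ∷ []) = ⊥
  UnCycle (_ ∷ _ ∷ []) = ⊥
  UnCycle (x ∷ y ∷ z ∷ rest) =
    Unique (x ∷ y ∷ z ∷ rest) × ClosesUp x x (y ∷ z ∷ rest)

  IsMultidiforest : Set
  IsMultidiforest = ∀ (c : List (Fin nV)) → ¬ UnCycle c

  VtxOf : Subset nE → Fin nV → Set
  VtxOf C x = ∃ λ e → e ∈ C × (src e ≡ x ⊎ tgt e ≡ x)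

  data Walk (C : Subset nE) : Fin nV → Fin nV → Set where
    here : ∀ {x} → Walk C x x
    fwd  : ∀ {z} (e : Fin nE) → e ∈ C → Walk C (tgt e) z → Walk C (src e) z
    bwd  : ∀ {z} (e : Fin nE) → e ∈ C → Walk C (src e) z → Walk C (tgt e) z

  ExactlyOne : (Fin nE → Set) → Set
  ExactlyOne P = (∃ λ e → P e) × (∀ e f → P e → P f → e ≡ f)

  IsDirCycle : Subset nE → Set
  IsDirCycle C =
    (∃ λ e → e ∈ C)
    × (∀ x → VtxOf C x → ExactlyOne (λ e → e ∈ C × src e ≡ x))
    × (∀ x → VtxOf C x → ExactlyOne (λ e → e ∈ C × tgt e ≡ x))
    × (∀ x y → VtxOf C x → VtxOf C y → Walk C x y)

  IsDirForest : Subset nE → Set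
  IsDirForest σ =
    (¬ ∃ λ C → C ⊆ σ × IsDirCycle C)
    × (∀ e f → e ∈ σ → f ∈ σ → tgt e ≡ tgt f → e ≡ f)

Complex : ℕ → Set₁
Complex m = Subset m → Set

DT : (G : Multidigraph) → Complex (Multidigraph.nE G)
DT G σ = IsDirForest G σ

lk : ∀ {m} → Fin m → Complex m → Complex m
lk v K τ = v ∉ τ × K (τ ∪ ⁅ v ⁆)

del : ∀ {m} → Fin m → Complex m → Complex m
del v K τ = v ∉ τ × K τ

IsSimplex : ∀ {m} → Complex m → Set
IsSimplex {m} K = ∃ λ (σ : Subset m) → ∀ τ → (K τ → τ ⊆ σ) × (τ ⊆ σ → K τ)

IsFacet : ∀ {m} → Complex m → Subset m → Set
IsFacet K σ = K σ × (∀ τ → K τ → σ ⊆ τ → τ ≡ σ)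

data VertexDecomposable {m} : Complex m → Set₁ where
  simplex : ∀ {K} → IsSimplex K → VertexDecomposable K
  shed    : ∀ {K} (v : Fin m)
          → K ⁅ v ⁆
          → VertexDecomposable (lk v K)
          → VertexDecomposable (del v K)
          → (∀ σ → IsFacet (del v K) σ → IsFacet K σ)
          → VertexDecomposable K

-- DT(F) is the independence complex of the conflict graph on the non-loop
-- edges of F, in which two edges conflict when they share a target or are
-- antiparallel: loops and antiparallel pairs are directed cycles, and in a
-- multidiforest there are no other minimal ones. An independence complex is
-- vertex decomposable as soon as every nonempty induced subgraph with an edge
-- has a vertex v dominating a neighbour u (N[u] ⊆ N[v]), for then v is a
-- shedding vertex and link and deletion are again independence complexes.
-- Such a pair is found by walking along a chain of antiparallel pairs in the
-- forest; the walk cannot backtrack, so it must stop, and where it stops a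
-- dominated pair appears.
module Submission where

open import Defs
open import Data.Nat using (ℕ; zero; suc; _+_; _≤_; _<_; z<s)
open import Data.Nat.Properties using (≤⇒≯; +-suc; m<m+n)
open import Data.Empty using (⊥; ⊥-elim)
open import Data.Unit using (⊤; tt)
open import Data.Bool using (false; true)
open import Data.Fin using (Fin; zero; suc; _≟_)
open import Data.Fin.Properties using (any?; injective⇒≤)
open import Data.Fin.Subset using (Subset; _∈_; _∉_; _⊆_; _⊂_; _∪_; _─_; _-_; ⁅_⁆)
open import Data.Fin.Subset.Properties
  using (_∈?_; x∈⁅x⁆; x∈⁅y⁆⇒x≡y; x∈p∪q⁻; p⊆p∪q; q⊆p∪q; x∈p∩q⁺; ⊆-refl; ⊆-trans;
         p─q⊆p; p∩q≢∅⇒p─q⊂p; x∈p∧x∉q⇒x∈p─q; x∈p∧x≢y⇒x∈p-y; x∈p⇒p-x⊂p)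
open import Data.Fin.Subset.Induction using (⊂-wellFounded)
open import Data.List using (List; []; _∷_; length; take; lookup)
open import Data.List.Membership.Propositional.Properties using (∈-lookup)
import Data.List.Relation.Unary.All as All
open import Data.List.Relation.Unary.All using ([]; _∷_)
open import Data.List.Relation.Unary.All.Properties.Core using (¬Any⇒All¬)
open import Data.List.Relation.Unary.AllPairs using ([]; _∷_)
open import Data.List.Relation.Unary.Any using (Any; here; there)
import Data.List.Relation.Unary.Any as Any
open import Data.List.Relation.Unary.Unique.Propositional using (Unique)
open import Data.List.Relation.Unary.Unique.Propositional.Properties using (take⁺)
open import Data.Vec.Base using ([]; _∷_; here; there)
open import Data.Product using (∃; ∃₂; _×_; _,_; proj₁; proj₂)
open import Data.Sum using (_⊎_; inj₁; inj₂; [_,_]′)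
open import Function using (_∘_)
open import Induction.WellFounded using (Acc; acc)
open import Relation.Binary.PropositionalEquality using (_≡_; _≢_; refl; sym; trans; subst; cong)
open import Relation.Nullary using (¬_; Dec; yes; no; does; ¬?)
open import Relation.Nullary.Decidable using (_×-dec_; _⊎-dec_; dec-true; decidable-stable)
open import Relation.Unary using (Pred; Decidable; _≐_)
open import Relation.Unary.Properties using (≐-sym)

select : ∀ {n ℓ} {P : Pred (Fin n) ℓ} → Decidable P → Subset n
select {zero}  P? = []
select {suc n} P? = does (P? zero) ∷ select (P? ∘ suc)

∈-select⁺ : ∀ {n ℓ} {P : Pred (Fin n) ℓ} (P? : Decidable P) {x} → P x → x ∈ select P?
∈-select⁺ P? {zero}  p rewrite dec-true (P? zero) p = here
∈-select⁺ P? {suc x} p = there (∈-select⁺ (P? ∘ suc) p)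

∈-select⁻ : ∀ {n ℓ} {P : Pred (Fin n) ℓ} (P? : Decidable P) {x} → x ∈ select P? → P x
∈-select⁻ P? {zero} x∈ with P? zero
∈-select⁻ P? {zero} here | yes p = p
∈-select⁻ P? {suc x} (there x∈) = ∈-select⁻ (P? ∘ suc) x∈

x∈p─q⁻ : ∀ {n} {x : Fin n} (p q : Subset n) → x ∈ p ─ q → x ∈ p × x ∉ q
x∈p─q⁻               (true  ∷ p) (false ∷ q) here = here , λ ()
x∈p─q⁻ {x = zero}    (false ∷ p) (false ∷ q) ()
x∈p─q⁻ {x = zero}    (_     ∷ p) (true  ∷ q) ()
x∈p─q⁻ {x = suc _}   (_     ∷ p) (_     ∷ q) (there x∈p─q) with x∈p─q⁻ p q x∈p─q
... | x∈p , x∉q = there x∈p , λ { (there x∈q) → x∉q x∈q }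

x∈p∪⁅y⁆⁻ : ∀ {n} {x y : Fin n} (p : Subset n) → x ∈ p ∪ ⁅ y ⁆ → x ∈ p ⊎ x ≡ y
x∈p∪⁅y⁆⁻ {y = y} p x∈ with x∈p∪q⁻ p ⁅ y ⁆ x∈
... | inj₁ x∈p = inj₁ x∈p
... | inj₂ x∈y = inj₂ (x∈⁅y⁆⇒x≡y y x∈y)

x∈⁅y⁆∪⁅z⁆⁻ : ∀ {n} {x y z : Fin n} → x ∈ ⁅ y ⁆ ∪ ⁅ z ⁆ → x ≡ y ⊎ x ≡ z
x∈⁅y⁆∪⁅z⁆⁻ {y = y} x∈ = [ inj₁ ∘ x∈⁅y⁆⇒x≡y y , inj₂ ]′ (x∈p∪⁅y⁆⁻ ⁅ y ⁆ x∈)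

module _ {m : ℕ} {K L : Complex m} where

  lk-resp-≐ : ∀ v → K ≐ L → lk v K ≐ lk v L
  lk-resp-≐ v (K⊆L , L⊆K) = (λ (v∉ , k) → v∉ , K⊆L k) , (λ (v∉ , l) → v∉ , L⊆K l)

  del-resp-≐ : ∀ v → K ≐ L → del v K ≐ del v L
  del-resp-≐ v (K⊆L , L⊆K) = (λ (v∉ , k) → v∉ , K⊆L k) , (λ (v∉ , l) → v∉ , L⊆K l)

  IsFacet-resp-≐ : K ≐ L → ∀ σ → IsFacet K σ → IsFacet L σ
  IsFacet-resp-≐ (K⊆L , L⊆K) σ (σ∈K , maximal) = K⊆L σ∈K , λ τ τ∈L → maximal τ (L⊆K τ∈L)

  IsSimplex-resp-≐ : K ≐ L → IsSimplex K → IsSimplex L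
  IsSimplex-resp-≐ (K⊆L , L⊆K) (σ , faces) =
    σ , λ τ → proj₁ (faces τ) ∘ L⊆K , K⊆L ∘ proj₂ (faces τ)

VertexDecomposable-resp-≐ : ∀ {m} {K L : Complex m} → K ≐ L → VertexDecomposable K → VertexDecomposable L
VertexDecomposable-resp-≐ K≐L (simplex K-simplex) = simplex (IsSimplex-resp-≐ K≐L K-simplex)
VertexDecomposable-resp-≐ K≐L@(K⊆L , _) (shed v v∈K lk-vd del-vd shedding) =
  shed v (K⊆L v∈K)
    (VertexDecomposable-resp-≐ (lk-resp-≐ v K≐L) lk-vd)
    (VertexDecomposable-resp-≐ (del-resp-≐ v K≐L) del-vd)
    λ σ → IsFacet-resp-≐ K≐L σ ∘ shedding σ ∘ IsFacet-resp-≐ (≐-sym (del-resp-≐ v K≐L)) σ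

-- Independence complexes

module IndependenceComplex {m : ℕ} (_#_ : Fin m → Fin m → Set)
  (#-irrefl : ∀ {e} → ¬ e # e) (#-sym : ∀ {e f} → e # f → f # e)
  (_#?_ : ∀ e f → Dec (e # f)) where

  Independent : Subset m → Set
  Independent τ = ∀ {e f} → e ∈ τ → f ∈ τ → ¬ e # f

  Ind : Subset m → Complex m
  Ind W τ = τ ⊆ W × Independent τ

  N[_] : Fin m → Subset m
  N[ v ] = select (λ e → (e ≟ v) ⊎-dec (v #? e))

  Conflicted : Subset m → Set
  Conflicted W = ∃₂ λ e f → e ∈ W × f ∈ W × e # f

  -- N[u] ⊆ N[v] in the graph induced on W, for neighbours u and v
  Dominates : Subset m → Fin m → Fin m → Set
  Dominates W v u = u ∈ W × v ∈ W × u # v × (∀ {w} → w ∈ W → u # w → w ≢ v → v # w)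

  conflicted? : ∀ W → Dec (Conflicted W)
  conflicted? W = any? λ e → any? λ f → e ∈? W ×-dec f ∈? W ×-dec e #? f

  independent-⁅⁆ : ∀ v → Independent ⁅ v ⁆
  independent-⁅⁆ v e∈ f∈ rewrite x∈⁅y⁆⇒x≡y v e∈ | x∈⁅y⁆⇒x≡y v f∈ = #-irrefl

  independent-∪⁅⁆ : ∀ {τ v} → Independent τ → (∀ {e} → e ∈ τ → ¬ v # e) → Independent (τ ∪ ⁅ v ⁆)
  independent-∪⁅⁆ {τ} ind ¬v#τ e∈ f∈ with x∈p∪⁅y⁆⁻ τ e∈ | x∈p∪⁅y⁆⁻ τ f∈
  ... | inj₁ e∈τ | inj₁ f∈τ = ind e∈τ f∈τ
  ... | inj₁ e∈τ | inj₂ refl = ¬v#τ e∈τ ∘ #-sym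
  ... | inj₂ refl | inj₁ f∈τ = ¬v#τ f∈τ
  ... | inj₂ refl | inj₂ refl = #-irrefl

  ⁅⁆∈Ind : ∀ {W v} → v ∈ W → Ind W ⁅ v ⁆
  ⁅⁆∈Ind {v = v} v∈W = (λ e∈ → subst (_∈ _) (sym (x∈⁅y⁆⇒x≡y v e∈)) v∈W) , independent-⁅⁆ v

  Ind-isSimplex : ∀ {W} → ¬ Conflicted W → IsSimplex (Ind W)
  Ind-isSimplex ¬conflict =
    _ , λ τ → proj₁ , λ τ⊆W → τ⊆W , λ e∈ f∈ e#f → ¬conflict (_ , _ , τ⊆W e∈ , τ⊆W f∈ , e#f)

  lk-Ind : ∀ {W v} → v ∈ W → lk v (Ind W) ≐ Ind (W ─ N[ v ])
  lk-Ind {W} {v} v∈W = to , from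
    where
    v∈τ∪v : ∀ τ → v ∈ τ ∪ ⁅ v ⁆
    v∈τ∪v τ = q⊆p∪q τ ⁅ v ⁆ (x∈⁅x⁆ v)

    to : ∀ {τ} → lk v (Ind W) τ → Ind (W ─ N[ v ]) τ
    to {τ} (v∉τ , τv⊆W , ind) =
      (λ e∈ → x∈p∧x∉q⇒x∈p─q (τv⊆W (p⊆p∪q ⁅ v ⁆ e∈)) λ e∈N → ∉τ-if-N[v] (∈-select⁻ _ e∈N) e∈)
      , λ e∈ f∈ → ind (p⊆p∪q ⁅ v ⁆ e∈) (p⊆p∪q ⁅ v ⁆ f∈)
      where
      ∉τ-if-N[v] : ∀ {e} → e ≡ v ⊎ v # e → e ∉ τ
      ∉τ-if-N[v] (inj₁ refl) = v∉τ
      ∉τ-if-N[v] (inj₂ v#e) e∈ = ind (v∈τ∪v τ) (p⊆p∪q ⁅ v ⁆ e∈) v#e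

    from : ∀ {τ} → Ind (W ─ N[ v ]) τ → lk v (Ind W) τ
    from {τ} (τ⊆ , ind) =
      (λ v∈τ → far v∈τ (inj₁ refl))
      , (λ e∈ → [ proj₁ ∘ x∈p─q⁻ W N[ v ] ∘ τ⊆ , (λ { refl → v∈W }) ]′ (x∈p∪⁅y⁆⁻ τ e∈))
      , independent-∪⁅⁆ ind (λ e∈ v#e → far e∈ (inj₂ v#e))
      where
      far : ∀ {e} → e ∈ τ → ¬ (e ≡ v ⊎ v # e)
      far e∈ = proj₂ (x∈p─q⁻ W N[ v ] (τ⊆ e∈)) ∘ ∈-select⁺ _

  del-Ind : ∀ {W v} → del v (Ind W) ≐ Ind (W - v)
  del-Ind {W} {v} =
    (λ (v∉τ , τ⊆W , ind) → (λ e∈ → x∈p∧x≢y⇒x∈p-y (τ⊆W e∈) λ { refl → v∉τ e∈ }) , ind)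
    , λ (τ⊆ , ind) → (λ v∈τ → proj₂ (x∈p─q⁻ W ⁅ v ⁆ (τ⊆ v∈τ)) (x∈⁅x⁆ v))
                     , proj₁ ∘ x∈p─q⁻ W ⁅ v ⁆ ∘ τ⊆ , ind

  facet-absorbs : ∀ {W v u σ} → IsFacet (del v (Ind W)) σ → u ∈ W → u ≢ v →
                  (∀ {w} → w ∈ σ → ¬ u # w) → u ∈ σ
  facet-absorbs {W} {v} {u} {σ} ((v∉σ , σ⊆W , ind) , maximal) u∈W u≢v ¬u#σ =
    subst (u ∈_) σ∪u≡σ (q⊆p∪q σ ⁅ u ⁆ (x∈⁅x⁆ u))
    where
    σ∪u≡σ : σ ∪ ⁅ u ⁆ ≡ σ
    σ∪u≡σ = maximal (σ ∪ ⁅ u ⁆)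
      ( [ v∉σ , (λ v≡u → u≢v (sym v≡u)) ]′ ∘ x∈p∪⁅y⁆⁻ σ
      , [ σ⊆W , (λ { refl → u∈W }) ]′ ∘ x∈p∪⁅y⁆⁻ σ
      , independent-∪⁅⁆ ind ¬u#σ )
      (p⊆p∪q ⁅ u ⁆)

  dominating-isShedding : ∀ {W v u} → Dominates W v u →
                          ∀ σ → IsFacet (del v (Ind W)) σ → IsFacet (Ind W) σ
  dominating-isShedding {W} {v} {u} (u∈W , _ , u#v , dominated) σ
                        σ-facet@((v∉σ , σ∈Ind) , maximal) = σ∈Ind , grow
    where
    grow : ∀ τ → Ind W τ → σ ⊆ τ → τ ≡ σ
    grow τ τ∈Ind@(_ , ind) σ⊆τ with v ∈? τ
    ... | no v∉τ = maximal τ (v∉τ , τ∈Ind) σ⊆τ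
    ... | yes v∈τ with any? (λ w → w ∈? σ ×-dec u #? w)
    ...   | yes (w , w∈σ , u#w) =
            ⊥-elim (ind v∈τ (σ⊆τ w∈σ) (dominated (proj₁ σ∈Ind w∈σ) u#w λ { refl → v∉σ w∈σ }))
    ...   | no ¬u#σ =
            ⊥-elim (ind (σ⊆τ (facet-absorbs σ-facet u∈W (λ { refl → #-irrefl u#v })
                                 λ w∈ u#w → ¬u#σ (_ , w∈ , u#w))) v∈τ u#v)

  Ind-vertexDecomposable : (W₀ : Subset m) → (∀ {W} → W ⊆ W₀ → Conflicted W → ∃₂ (Dominates W)) →
                           ∀ {W} → W ⊆ W₀ → VertexDecomposable (Ind W)
  Ind-vertexDecomposable W₀ dominatedPair = go (⊂-wellFounded _)
    where
    go : ∀ {W} → Acc _⊂_ W → W ⊆ W₀ → VertexDecomposable (Ind W)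
    go {W} (acc smaller) W⊆W₀ with conflicted? W
    ... | no ¬conflict = simplex (Ind-isSimplex ¬conflict)
    ... | yes conflict with dominatedPair W⊆W₀ conflict
    ...   | v , u , v-dominates@(_ , v∈W , _) =
            shed v (⁅⁆∈Ind v∈W)
              (VertexDecomposable-resp-≐ (≐-sym (lk-Ind v∈W))
                (go (smaller W─N[v]⊂W) (⊆-trans (p─q⊆p W N[ v ]) W⊆W₀)))
              (VertexDecomposable-resp-≐ (≐-sym del-Ind)
                (go (smaller (x∈p⇒p-x⊂p v∈W)) (⊆-trans (p─q⊆p W ⁅ v ⁆) W⊆W₀)))
              (dominating-isShedding v-dominates)
      where
      W─N[v]⊂W : W ─ N[ v ] ⊂ W
      W─N[v]⊂W = p∩q≢∅⇒p─q⊂p W N[ v ] (v , x∈p∩q⁺ (v∈W , ∈-select⁺ _ (inj₁ refl)))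

-- Non-backtracking walks in forests

lookup-injective : ∀ {A : Set} {xs : List A} → Unique xs → ∀ {i j} → lookup xs i ≡ lookup xs j → i ≡ j
lookup-injective (_ ∷ _)     {zero}  {zero}  _  = refl
lookup-injective (x∉xs ∷ _)  {zero}  {suc j} eq = ⊥-elim (All.lookup x∉xs (∈-lookup j) eq)
lookup-injective (x∉xs ∷ _)  {suc i} {zero}  eq = ⊥-elim (All.lookup x∉xs (∈-lookup i) (sym eq))
lookup-injective (_ ∷ uniq)  {suc i} {suc j} eq = cong suc (lookup-injective uniq eq)

Unique⇒length≤ : ∀ {n} {xs : List (Fin n)} → Unique xs → length xs ≤ n
Unique⇒length≤ uniq = injective⇒≤ (lookup-injective uniq)

module Forest (G : Multidigraph) (forest : IsMultidiforest G) where
  open Multidigraph G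

  Adj-sym : ∀ {x y} → Adj G x y → Adj G y x
  Adj-sym (x≢y , e , inj₁ st) = x≢y ∘ sym , e , inj₂ st
  Adj-sym (x≢y , e , inj₂ st) = x≢y ∘ sym , e , inj₁ st

  Chain : Fin nV → List (Fin nV) → Set
  Chain x []       = ⊤
  Chain x (y ∷ ys) = Adj G x y × Chain y ys

  Chain-closesUp : ∀ {first x c ys} → Chain x ys → Any (c ≡_) ys → Adj G c first →
                   ∃ λ k → ClosesUp G first x (take (suc k) ys)
  Chain-closesUp (x~y , _)  (here refl) c~first = 0 , x~y , c~first
  Chain-closesUp (x~y , ch) (there c∈)  c~first with Chain-closesUp ch c∈ c~first
  ... | k , closes = suc k , x~y , closes

  no-shortcut : ∀ {a b c rest} → Unique (b ∷ a ∷ rest) → Chain b (a ∷ rest) →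
                Any (c ≡_) rest → Adj G c b → ⊥
  no-shortcut {a} {b} {rest = r ∷ rest} uniq (b~a , ch) c∈ c~b with Chain-closesUp ch c∈ c~b
  ... | k , closes = forest (b ∷ a ∷ r ∷ take k rest) (take⁺ (3 + k) uniq , b~a , closes)

  module _ {Q : Set} (R : Fin nV → Fin nV → Set) (R⇒Adj : ∀ {x y} → R x y → Adj G x y)
           (continue : ∀ {a b} → R a b → Q ⊎ ∃ λ c → c ≢ a × R b c) where

    -- The visited vertices, most recent first, form a path of G^un; the fuel
    -- runs out only when that path would be longer than nV.
    private
      walk : ∀ fuel {a b rest} → R a b → Unique (b ∷ a ∷ rest) → Chain b (a ∷ rest) →
             nV < fuel + length (b ∷ a ∷ rest) → Q
      walk zero _ uniq _ long = ⊥-elim (≤⇒≯ (Unique⇒length≤ uniq) long)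
      walk (suc fuel) {a} {b} {rest} r uniq ch long with continue r
      ... | inj₁ q = q
      ... | inj₂ (c , c≢a , r′) with Any.any? (c ≟_) (b ∷ a ∷ rest)
      ...   | yes (here refl)              = ⊥-elim (proj₁ (R⇒Adj r′) refl)
      ...   | yes (there (here refl))      = ⊥-elim (c≢a refl)
      ...   | yes (there (there c∈rest))   = ⊥-elim (no-shortcut uniq ch c∈rest (Adj-sym (R⇒Adj r′)))
      ...   | no c∉                        =
              walk fuel r′ (¬Any⇒All¬ _ c∉ ∷ uniq) (Adj-sym (R⇒Adj r′) , ch)
                   (subst (nV <_) (sym (+-suc fuel _)) long)

    nonBacktracking-ends : ∀ {a b} → R a b → Q
    nonBacktracking-ends {a} {b} r =
      walk nV r ((proj₁ b~a ∷ []) ∷ [] ∷ []) (b~a , tt) (m<m+n nV z<s)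
      where
      b~a : Adj G b a
      b~a = Adj-sym (R⇒Adj r)

-- The conflict graph of a multidigraph

module ConflictGraph (G : Multidigraph) where
  open Multidigraph G

  Loop : Fin nE → Set
  Loop e = src e ≡ tgt e

  Antiparallel : Fin nE → Fin nE → Set
  Antiparallel e f = src e ≡ tgt f × src f ≡ tgt e

  antiparallel? : ∀ e f → Dec (Antiparallel e f)
  antiparallel? e f = (src e ≟ tgt f) ×-dec (src f ≟ tgt e)

  _#_ : Fin nE → Fin nE → Set
  e # f = e ≢ f × (tgt e ≡ tgt f ⊎ Antiparallel e f)

  #-irrefl : ∀ {e} → ¬ e # e
  #-irrefl (e≢e , _) = e≢e refl

  #-sym : ∀ {e f} → e # f → f # e
  #-sym (e≢f , inj₁ tgt≡) = e≢f ∘ sym , inj₁ (sym tgt≡)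
  #-sym (e≢f , inj₂ (se≡tf , sf≡te)) = e≢f ∘ sym , inj₂ (sf≡te , se≡tf)

  _#?_ : ∀ e f → Dec (e # f)
  e #? f = ¬? (e ≟ f) ×-dec ((tgt e ≟ tgt f) ⊎-dec antiparallel? e f)

  open IndependenceComplex _#_ #-irrefl #-sym _#?_ public

  nonLoops : Subset nE
  nonLoops = select (λ e → ¬? (src e ≟ tgt e))

  -- e ≡ f is allowed here, and then ⁅ e ⁆ ∪ ⁅ e ⁆ is the cycle formed by a loop.
  antiparallel-isDirCycle : ∀ {e f} → Antiparallel e f → (Loop e → e ≡ f) → IsDirCycle G (⁅ e ⁆ ∪ ⁅ f ⁆)
  antiparallel-isDirCycle {e} {f} (se≡tf , sf≡te) loop⇒e≡f = (e , e∈C) , outs , ins , walks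
    where
    C : Subset nE
    C = ⁅ e ⁆ ∪ ⁅ f ⁆
    e∈C : e ∈ C
    e∈C = p⊆p∪q ⁅ f ⁆ (x∈⁅x⁆ e)
    f∈C : f ∈ C
    f∈C = q⊆p∪q ⁅ e ⁆ ⁅ f ⁆ (x∈⁅x⁆ f)

    endpoint : ∀ {x} → VtxOf G C x → x ≡ src e ⊎ x ≡ tgt e
    endpoint (g , g∈ , st) with x∈⁅y⁆∪⁅z⁆⁻ g∈ | st
    ... | inj₁ refl | inj₁ sg≡x = inj₁ (sym sg≡x)
    ... | inj₁ refl | inj₂ tg≡x = inj₂ (sym tg≡x)
    ... | inj₂ refl | inj₁ sg≡x = inj₂ (trans (sym sg≡x) sf≡te)
    ... | inj₂ refl | inj₂ tg≡x = inj₁ (trans (sym tg≡x) (sym se≡tf))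

    outs : ∀ x → VtxOf G C x → ExactlyOne G (λ g → g ∈ C × src g ≡ x)
    outs x x∈ = out (endpoint x∈) , unique
      where
      out : x ≡ src e ⊎ x ≡ tgt e → ∃ λ g → g ∈ C × src g ≡ x
      out (inj₁ refl) = e , e∈C , refl
      out (inj₂ refl) = f , f∈C , sf≡te
      unique : ∀ g h → g ∈ C × src g ≡ x → h ∈ C × src h ≡ x → g ≡ h
      unique g h (g∈ , sg≡x) (h∈ , sh≡x) with x∈⁅y⁆∪⁅z⁆⁻ g∈ | x∈⁅y⁆∪⁅z⁆⁻ h∈
      ... | inj₁ refl | inj₁ refl = refl
      ... | inj₂ refl | inj₂ refl = refl
      ... | inj₁ refl | inj₂ refl = loop⇒e≡f (trans (trans sg≡x (sym sh≡x)) sf≡te)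
      ... | inj₂ refl | inj₁ refl = sym (loop⇒e≡f (trans (trans sh≡x (sym sg≡x)) sf≡te))

    ins : ∀ x → VtxOf G C x → ExactlyOne G (λ g → g ∈ C × tgt g ≡ x)
    ins x x∈ = inn (endpoint x∈) , unique
      where
      inn : x ≡ src e ⊎ x ≡ tgt e → ∃ λ g → g ∈ C × tgt g ≡ x
      inn (inj₁ refl) = f , f∈C , sym se≡tf
      inn (inj₂ refl) = e , e∈C , refl
      unique : ∀ g h → g ∈ C × tgt g ≡ x → h ∈ C × tgt h ≡ x → g ≡ h
      unique g h (g∈ , tg≡x) (h∈ , th≡x) with x∈⁅y⁆∪⁅z⁆⁻ g∈ | x∈⁅y⁆∪⁅z⁆⁻ h∈
      ... | inj₁ refl | inj₁ refl = refl
      ... | inj₂ refl | inj₂ refl = refl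
      ... | inj₁ refl | inj₂ refl = loop⇒e≡f (trans se≡tf (trans th≡x (sym tg≡x)))
      ... | inj₂ refl | inj₁ refl = sym (loop⇒e≡f (trans se≡tf (trans tg≡x (sym th≡x))))

    walks : ∀ x y → VtxOf G C x → VtxOf G C y → Walk G C x y
    walks x y x∈ y∈ = walk (endpoint x∈) (endpoint y∈)
      where
      walk : ∀ {x y} → x ≡ src e ⊎ x ≡ tgt e → y ≡ src e ⊎ y ≡ tgt e → Walk G C x y
      walk (inj₁ refl) (inj₁ refl) = here
      walk (inj₁ refl) (inj₂ refl) = fwd e e∈C here
      walk (inj₂ refl) (inj₁ refl) = bwd e e∈C here
      walk (inj₂ refl) (inj₂ refl) = here

  dirForest⇒Ind : ∀ {τ} → IsDirForest G τ → Ind nonLoops τ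
  dirForest⇒Ind {τ} (acyclic , distinctTargets) = ∈-select⁺ _ ∘ nonLoop , independent
    where
    pair⊆τ : ∀ {e f} → e ∈ τ → f ∈ τ → ⁅ e ⁆ ∪ ⁅ f ⁆ ⊆ τ
    pair⊆τ e∈ f∈ g∈ = [ (λ { refl → e∈ }) , (λ { refl → f∈ }) ]′ (x∈⁅y⁆∪⁅z⁆⁻ g∈)

    nonLoop : ∀ {e} → e ∈ τ → ¬ Loop e
    nonLoop e∈ loop = acyclic (_ , pair⊆τ e∈ e∈ , antiparallel-isDirCycle (loop , loop) λ _ → refl)

    independent : Independent τ
    independent e∈ f∈ (e≢f , inj₁ tgt≡) = e≢f (distinctTargets _ _ e∈ f∈ tgt≡)
    independent e∈ f∈ (_ , inj₂ anti) =
      acyclic (_ , pair⊆τ e∈ f∈ , antiparallel-isDirCycle anti (⊥-elim ∘ nonLoop e∈))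

  parallel-dominates : ∀ {W g e} → g ∈ W → e ∈ W → g ≢ e →
                       src g ≡ src e → tgt g ≡ tgt e → Dominates W e g
  parallel-dominates g∈W e∈W g≢e sg≡se tg≡te = g∈W , e∈W , (g≢e , inj₁ tg≡te) , λ where
    _ (_ , inj₁ tg≡tw)           w≢e → w≢e ∘ sym , inj₁ (trans (sym tg≡te) tg≡tw)
    _ (_ , inj₂ (sg≡tw , sw≡tg)) w≢e → w≢e ∘ sym , inj₂ (trans (sym sg≡se) sg≡tw , trans sw≡tg tg≡te)

  unreversed-dominates : ∀ {W g e} → g ∈ W → e ∈ W → g ≢ e → tgt g ≡ tgt e →
                         (∀ {h} → h ∈ W → ¬ Antiparallel g h) → Dominates W e g
  unreversed-dominates g∈W e∈W g≢e tg≡te unreversed = g∈W , e∈W , (g≢e , inj₁ tg≡te) , λ where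
    _   (_ , inj₁ tg≡tw) w≢e → w≢e ∘ sym , inj₁ (trans (sym tg≡te) tg≡tw)
    w∈W (_ , inj₂ anti)  _   → ⊥-elim (unreversed w∈W anti)

  lonelyTarget-dominates : ∀ {W e f} → e ∈ W → f ∈ W → e ≢ f → Antiparallel e f →
                           (∀ {g} → g ∈ W → tgt g ≡ tgt e → g ≡ e) → Dominates W f e
  lonelyTarget-dominates e∈W f∈W e≢f anti@(se≡tf , _) lonely = e∈W , f∈W , (e≢f , inj₂ anti) , λ where
    w∈W (e≢w , inj₁ te≡tw)   _   → ⊥-elim (e≢w (sym (lonely w∈W (sym te≡tw))))
    _   (_ , inj₂ (se≡tw , _)) w≢f → w≢f ∘ sym , inj₁ (trans (sym se≡tf) se≡tw)

  module _ (forest : IsMultidiforest G) where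
    open Forest G forest

    Ind⇒dirForest : ∀ {τ} → Ind nonLoops τ → IsDirForest G τ
    Ind⇒dirForest {τ} (τ⊆ , independent) = acyclic , distinctTargets
      where
      nonLoop : ∀ {e} → e ∈ τ → ¬ Loop e
      nonLoop = ∈-select⁻ _ ∘ τ⊆

      distinctTargets : ∀ e f → e ∈ τ → f ∈ τ → tgt e ≡ tgt f → e ≡ f
      distinctTargets e f e∈ f∈ tgt≡ with e ≟ f
      ... | yes e≡f = e≡f
      ... | no e≢f = ⊥-elim (independent e∈ f∈ (e≢f , inj₁ tgt≡))

      -- Following a directed cycle backwards never returns along the edge
      -- just used, since a loop or an antiparallel pair would be dependent.
      acyclic : ¬ ∃ λ C → C ⊆ τ × IsDirCycle G C
      acyclic (C , C⊆τ , (e , e∈C) , _ , ins , _) =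
        nonBacktracking-ends Backwards Backwards⇒Adj continue (e , e∈C , refl , refl)
        where
        Backwards : Fin nV → Fin nV → Set
        Backwards x y = ∃ λ e → e ∈ C × src e ≡ y × tgt e ≡ x

        Backwards⇒Adj : ∀ {x y} → Backwards x y → Adj G x y
        Backwards⇒Adj (e , e∈C , refl , refl) = nonLoop (C⊆τ e∈C) ∘ sym , e , inj₂ (refl , refl)

        continue : ∀ {a b} → Backwards a b → ⊥ ⊎ ∃ λ c → c ≢ a × Backwards b c
        continue (e , e∈C , refl , refl) with ins (src e) (e , e∈C , inj₁ refl)
        ... | (g , g∈C , tg≡se) , _ = inj₂ (src g , sg≢te , g , g∈C , refl , tg≡se)
          where
          sg≢te : src g ≢ tgt e
          sg≢te sg≡te = independent (C⊆τ e∈C) (C⊆τ g∈C)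
            ((λ { refl → nonLoop (C⊆τ e∈C) (sym tg≡se) }) , inj₂ (sym tg≡se , sg≡te))

    DT≐Ind : DT G ≐ Ind nonLoops
    DT≐Ind = dirForest⇒Ind , Ind⇒dirForest

    dominatedPair : ∀ {W} → W ⊆ nonLoops → Conflicted W → ∃₂ (Dominates W)
    dominatedPair {W} W⊆nonLoops (u , v , u∈W , v∈W , u#v) = fromConflict u#v
      where
      nonLoop : ∀ {e} → e ∈ W → ¬ Loop e
      nonLoop = ∈-select⁻ _ ∘ W⊆nonLoops

      TwoCycle : Fin nV → Fin nV → Set
      TwoCycle a b = ∃₂ λ e f → e ∈ W × f ∈ W × src e ≡ a × tgt e ≡ b × Antiparallel e f

      TwoCycle⇒Adj : ∀ {a b} → TwoCycle a b → Adj G a b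
      TwoCycle⇒Adj (e , _ , e∈W , _ , refl , refl , _) = nonLoop e∈W , e , inj₁ (refl , refl)

      -- Unless a dominated pair shows up at b, some other edge g enters b and
      -- is reversed by an edge h of W, so the walk moves on to src g.
      continue : ∀ {a b} → TwoCycle a b → ∃₂ (Dominates W) ⊎ ∃ λ c → c ≢ a × TwoCycle b c
      continue (e , f , e∈W , f∈W , refl , refl , anti)
        with any? (λ g → g ∈? W ×-dec (tgt g ≟ tgt e) ×-dec ¬? (g ≟ e))
      ... | no ¬rival = inj₁ (f , e , lonelyTarget-dominates e∈W f∈W e≢f anti lonely)
        where
        e≢f : e ≢ f
        e≢f refl = nonLoop e∈W (proj₁ anti)
        lonely : ∀ {g} → g ∈ W → tgt g ≡ tgt e → g ≡ e
        lonely g∈W tg≡te = decidable-stable (_ ≟ _) λ g≢e → ¬rival (_ , g∈W , tg≡te , g≢e)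
      ... | yes (g , g∈W , tg≡te , g≢e) with src g ≟ src e
      ...   | yes sg≡se = inj₁ (e , g , parallel-dominates g∈W e∈W g≢e sg≡se tg≡te)
      ...   | no sg≢se with any? (λ h → h ∈? W ×-dec antiparallel? g h)
      ...     | yes (h , h∈W , sg≡th , sh≡tg) =
                inj₂ (src g , sg≢se , h , g , h∈W , g∈W , trans sh≡tg tg≡te , sym sg≡th , sh≡tg , sg≡th)
      ...     | no ¬reversed =
                inj₁ (e , g , unreversed-dominates g∈W e∈W g≢e tg≡te λ h∈W anti′ → ¬reversed (_ , h∈W , anti′))

      fromTwoCycle : ∀ {a b} → TwoCycle a b → ∃₂ (Dominates W)
      fromTwoCycle = nonBacktracking-ends TwoCycle TwoCycle⇒Adj continue

      fromConflict : u # v → ∃₂ (Dominates W)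
      fromConflict (_ , inj₂ anti) = fromTwoCycle (u , v , u∈W , v∈W , refl , refl , anti)
      fromConflict (u≢v , inj₁ tu≡tv) with any? (λ h → h ∈? W ×-dec antiparallel? u h)
      ... | yes (h , h∈W , anti) = fromTwoCycle (u , h , u∈W , h∈W , refl , refl , anti)
      ... | no ¬reversed =
            v , u , unreversed-dominates u∈W v∈W u≢v tu≡tv λ h∈W anti → ¬reversed (_ , h∈W , anti)

theorem5p2 : (F : Multidigraph) → IsMultidiforest F → VertexDecomposable (DT F)
theorem5p2 F forest =
  VertexDecomposable-resp-≐ (≐-sym (DT≐Ind forest))
    (Ind-vertexDecomposable nonLoops (dominatedPair forest) ⊆-refl)
  where open ConflictGraph F
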